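{- Let $n$ and $k$ be integers with $2\le k\le n$ and let $G$ be a simple graph of order $n$ with complement $\overline{G}$. If $\lambda_k(G)+\lambda_k(\overline{G})=n-\lceil\frac{k}{2}\rceil$, then $\Delta(G)-\delta(G)\leq \lceil\frac{k}{2}\rceil-1$, where $\Delta(G)$ and $\delta(G)$ are the maximum and minimum degrees of $G$.
   Context: All graphs are finite, simple and undirected. For a graph $G$ and a vertex set $S\subseteq V(G)$ with $|S|\ge 2$, an $S$-Steiner tree is a subgraph of $G$ which is a tree and contains every vertex of $S$. $\lambda(S)$ denotes the maximum number of pairwise edge-disjoint $S$-Steiner trees in $G$. For an integer $k$ with $2\le k\le |V(G)|$, the generalized $k$-edge-connectivity is $\lambda_k(G)=\min\{\lambda(S): S\subseteq V(G),\ |S|=k\}$, with the convention $\lambda_k(G)=0$ if $G$ is disconnected. $\overline{G}$ is the complement of $G$. -}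

module Defs where

open import Data.Nat using (ℕ; zero; suc; _+_; _≤_; _∸_; _⊔_; _⊓_)
open import Data.Bool using (Bool; true; false; not; if_then_else_)
open import Data.Fin using (Fin; _≟_)
open import Data.Fin.Subset using (Subset; _∈_; _⊆_; ∣_∣)
open import Data.List using (List; []; _∷_; _++_; [_]; length; map; foldr; allFin)
open import Data.Nat.ListAction using (sum)
open import Data.Empty using (⊥-elim)
open import Data.List.Relation.Unary.Linked using (Linked)
open import Data.List.Relation.Unary.Unique.Propositional using (Unique)
open import Data.Product using (Σ; _×_; _,_)
open import Data.Sum using (_⊎_)
open import Relation.Nullary using (¬_; does; yes; no)
open import Relation.Binary.PropositionalEquality using (_≡_; _≢_; refl; sym)

record Graph (n : ℕ) : Set where
  field
    adj    : Fin n → Fin n → Bool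
    adj-sym : ∀ u v → adj u v ≡ adj v u
    irrefl : ∀ v → adj v v ≡ false
open Graph public

compAdj : ∀ {n} → Graph n → Fin n → Fin n → Bool
compAdj G u v = if does (u ≟ v) then false else not (adj G u v)

compAdj-sym : ∀ {n} (G : Graph n) u v → compAdj G u v ≡ compAdj G v u
compAdj-sym G u v with u ≟ v | v ≟ u
... | yes refl | yes _ = refl
... | yes refl | no ¬p = ⊥-elim (¬p refl)
... | no ¬p | yes refl = ⊥-elim (¬p refl)
... | no _ | no _ rewrite adj-sym G u v = refl

compAdj-irrefl : ∀ {n} (G : Graph n) v → compAdj G v v ≡ false
compAdj-irrefl G v with v ≟ v
... | yes _ = refl
... | no ¬p = ⊥-elim (¬p refl)

complement : ∀ {n} → Graph n → Graph n
complement G = record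
  { adj = compAdj G ; adj-sym = compAdj-sym G ; irrefl = compAdj-irrefl G }

data Walk {n : ℕ} (E : Fin n → Fin n → Bool) : Fin n → Fin n → Set where
  here : ∀ {u} → Walk E u u
  step : ∀ {u w v} → E u w ≡ true → Walk E w v → Walk E u v

Connected : ∀ {n} → Graph n → Set
Connected G = ∀ u v → Walk (adj G) u v

record Subgraph {n : ℕ} (G : Graph n) : Set where
  field
    V     : Subset n
    E     : Fin n → Fin n → Bool
    E-sym : ∀ u v → E u v ≡ E v u
    E⊆G   : ∀ u v → E u v ≡ true → adj G u v ≡ true
    E-end : ∀ u v → E u v ≡ true → u ∈ V
open Subgraph public

HasCycle : ∀ {n} → (Fin n → Fin n → Bool) → Set
HasCycle {n} E =
  Σ (Fin n) λ x → Σ (List (Fin n)) λ ys →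
    (2 ≤ length ys) × Unique (x ∷ ys) × Linked (λ a b → E a b ≡ true) (x ∷ ys ++ [ x ])

IsTree : ∀ {n} {G : Graph n} → Subgraph G → Set
IsTree T = (∀ u v → u ∈ V T → v ∈ V T → Walk (E T) u v) × ¬ HasCycle (E T)

record SteinerTree {n : ℕ} (G : Graph n) (S : Subset n) : Set where
  field
    tree   : Subgraph G
    isTree : IsTree tree
    S⊆V    : S ⊆ V tree
open SteinerTree public

HasDisjointTrees : ∀ {n} → Graph n → Subset n → ℕ → Set
HasDisjointTrees {n} G S m =
  Σ (Fin m → SteinerTree G S) λ T →
    ∀ i j → i ≢ j → ∀ u v → E (tree (T i)) u v ≡ true → E (tree (T j)) u v ≡ false

IsLambda : ∀ {n} → Graph n → Subset n → ℕ → Set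
IsLambda G S ℓ = HasDisjointTrees G S ℓ × (∀ m → HasDisjointTrees G S m → m ≤ ℓ)

IsLambdaK : ∀ {n} → Graph n → ℕ → ℕ → Set
IsLambdaK {n} G k ℓ =
  (¬ Connected G × ℓ ≡ 0) ⊎
  (Connected G ×
    Σ (Subset n) (λ S → ∣ S ∣ ≡ k × IsLambda G S ℓ) ×
    (∀ S → ∣ S ∣ ≡ k → ∀ ℓ' → IsLambda G S ℓ' → ℓ ≤ ℓ'))

degree : ∀ {n} → Graph n → Fin n → ℕ
degree {n} G v = sum (map (λ w → if adj G v w then 1 else 0) (allFin n))

maxDegree : ∀ {n} → Graph n → ℕ
maxDegree {n} G = foldr _⊔_ 0 (map (degree G) (allFin n))

-- minimum degree (the seed n exceeds every degree, so for n ≥ 1 this is the true minimum)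
minDegree : ∀ {n} → Graph n → ℕ
minDegree {n} G = foldr _⊓_ n (map (degree G) (allFin n))

-- Every S-Steiner tree through a vertex v and a second vertex of S has an edge at v, and
-- edge-disjoint trees use distinct such edges; choosing a k-set S through v thus gives
-- λₖ(H) ≤ δ(H) for every graph H. Applied to G and to its complement, where
-- δ(Ḡ) = n − 1 − Δ(G), the hypothesis λₖ(G) + λₖ(Ḡ) = n − ⌈k/2⌉ yields
-- Δ(G) ≤ n − 1 − λₖ(Ḡ) = λₖ(G) + ⌈k/2⌉ − 1 ≤ δ(G) + ⌈k/2⌉ − 1.
module Submission where

open import Defs
open import Data.Nat using (ℕ; _≤_; _+_; _∸_; ⌈_/2⌉)
open import Relation.Binary.PropositionalEquality using (_≡_)

open import Data.Nat using (zero; suc; z≤n; s≤s; s≤s⁻¹; _<_; _≤?_)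
open import Data.Nat.Properties
  using ( ≤-refl; ≤-trans; ≤-<-trans; +-suc; ≤-reflexive; ≤∧≢⇒<; m<1+n⇒m≤n; +-monoˡ-≤; +-cancelˡ-≤
        ; m≤m+n; m∸n≤m; m∸n+n≡m; m≤o∸n⇒m+n≤o; m≤n+o⇒m∸n≤o; ∸-monoʳ-≤; ⌈n/2⌉≤n
        ; ⊔-lub; ⊓-glb; ≰⇒>; ≤-antisym; module ≤-Reasoning )
open import Data.Nat.Tactic.RingSolver using (solve-∀)
open import Data.Nat.ListAction using (sum)
open import Data.Bool using (Bool; true; false; if_then_else_)
open import Data.Fin as Fin using (Fin; _≟_)
open import Data.Fin.Properties using (suc-injective; any?)
open import Data.Fin.Subset using (Subset; _∈_; _∉_; _⊆_; ∣_∣; ∁; _-_; ⁅_⁆; inside; outside)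
open import Data.Fin.Subset.Properties
  using ( ∣p∣≤n; ∣∁p∣≡n∸∣p∣; x∈p⇒∣p-x∣<∣p∣; x∈p∧x≢y⇒x∈p-y; p⊆q⇒∣p∣≤∣q∣; x∉p⇒x∈∁p
        ; x∈⁅x⁆; ∣⁅x⁆∣≡1; _∈?_; s⊆s; out⊆ )
open import Data.Vec using ([]; _∷_; tabulate)
open import Data.Vec.Properties using (lookup∘tabulate; lookup⇒[]=; []=⇒lookup)
import Data.List as List
open import Data.List.Properties using (map-tabulate; foldr-preservesᵇ)
open import Data.List.Relation.Unary.All.Properties using (map⁺; tabulate⁺)
open import Data.Product using (∃; _×_; _,_; proj₁; proj₂)
open import Data.Sum using (inj₁; inj₂)
open import Function using (_∘_)
open import Function.Definitions using (Injective)
open import Relation.Nullary using (¬_; yes; no; contradiction)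
open import Relation.Nullary.Decidable using (decidable-stable; ¬¬-excluded-middle; _×-dec_; ¬?)
open import Relation.Nullary.Negation using (¬¬-map)
open import Relation.Binary.PropositionalEquality using (refl; sym; trans; cong; subst; _≢_)

module _ {n : ℕ} {f : Fin n → Bool} where

  ∈-tabulate⁺ : ∀ {w} → f w ≡ true → w ∈ tabulate f
  ∈-tabulate⁺ {w} fw = lookup⇒[]= w (tabulate f) (trans (lookup∘tabulate f w) fw)

  ∈-tabulate⁻ : ∀ {w} → w ∈ tabulate f → f w ≡ true
  ∈-tabulate⁻ {w} w∈f = trans (sym (lookup∘tabulate f w)) ([]=⇒lookup w∈f)

  ∉-tabulate : ∀ {w} → f w ≡ false → w ∉ tabulate f
  ∉-tabulate fw≡false w∈f with trans (sym fw≡false) (∈-tabulate⁻ w∈f)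
  ... | ()

sum-indicator≡∣tabulate∣ : ∀ {n} (f : Fin n → Bool) →
  sum (List.tabulate (λ w → if f w then 1 else 0)) ≡ ∣ tabulate f ∣
sum-indicator≡∣tabulate∣ {zero}  f = refl
sum-indicator≡∣tabulate∣ {suc n} f with f Fin.zero
... | true  = cong suc (sum-indicator≡∣tabulate∣ (f ∘ Fin.suc))
... | false = sum-indicator≡∣tabulate∣ (f ∘ Fin.suc)

injection⇒≤∣p∣ : ∀ {m n} {p : Subset n} (g : Fin m → Fin n) →
  Injective _≡_ _≡_ g → (∀ i → g i ∈ p) → m ≤ ∣ p ∣
injection⇒≤∣p∣ {zero}  g _ _ = z≤n
injection⇒≤∣p∣ {suc m} {p = p} g g-inj g∈p =
  ≤-trans (s≤s rest≤∣p-g₀∣) (x∈p⇒∣p-x∣<∣p∣ (g∈p Fin.zero))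
  where
  rest≤∣p-g₀∣ : m ≤ ∣ p - g Fin.zero ∣
  rest≤∣p-g₀∣ = injection⇒≤∣p∣ {p = p - g Fin.zero} (g ∘ Fin.suc) (suc-injective ∘ g-inj)
    λ i → x∈p∧x≢y⇒x∈p-y (g∈p (Fin.suc i)) λ e → contradiction (g-inj e) λ ()

neighbours : ∀ {n} → Graph n → Fin n → Subset n
neighbours G v = tabulate (adj G v)

degree≡∣neighbours∣ : ∀ {n} (G : Graph n) v → degree G v ≡ ∣ neighbours G v ∣
degree≡∣neighbours∣ G v = trans (cong sum (map-tabulate (λ w → w) (λ w → if adj G v w then 1 else 0))) (sum-indicator≡∣tabulate∣ (adj G v))

injection⇒≤degree : ∀ {m n} (G : Graph n) {v} (g : Fin m → Fin n) →
  Injective _≡_ _≡_ g → (∀ i → adj G v (g i) ≡ true) → m ≤ degree G v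
injection⇒≤degree G {v} g g-inj g-adj =
  ≤-trans (injection⇒≤∣p∣ g g-inj (∈-tabulate⁺ ∘ g-adj)) (≤-reflexive (sym (degree≡∣neighbours∣ G v)))

complement-edge : ∀ {n} (G : Graph n) {v w} → adj (complement G) v w ≡ true → v ≢ w × adj G v w ≡ false
complement-edge G {v} {w} e with v ≟ w | adj G v w
complement-edge G () | yes _ | _
complement-edge G () | no _ | true
... | no v≢w | false = v≢w , refl

neighbours-complement⊆ : ∀ {n} (G : Graph n) v → neighbours (complement G) v ⊆ ∁ (neighbours G v) - v
neighbours-complement⊆ G v w∈N̄ =
  let v≢w , ¬vw = complement-edge G (∈-tabulate⁻ w∈N̄)
  in x∈p∧x≢y⇒x∈p-y (x∉p⇒x∈∁p (∉-tabulate ¬vw)) (v≢w ∘ sym)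

degree-complement+degree<n : ∀ {n} (G : Graph n) v → degree (complement G) v + degree G v < n
degree-complement+degree<n {n} G v
  rewrite degree≡∣neighbours∣ G v | degree≡∣neighbours∣ (complement G) v =
  m≤o∸n⇒m+n≤o (suc ∣ N̄ ∣) (∣p∣≤n N) (begin
    suc ∣ N̄ ∣         ≤⟨ s≤s (p⊆q⇒∣p∣≤∣q∣ (neighbours-complement⊆ G v)) ⟩
    suc ∣ ∁ N - v ∣   ≤⟨ x∈p⇒∣p-x∣<∣p∣ (x∉p⇒x∈∁p {p = N} (∉-tabulate {f = adj G v} (irrefl G v))) ⟩
    ∣ ∁ N ∣           ≡⟨ ∣∁p∣≡n∸∣p∣ N ⟩
    n ∸ ∣ N ∣         ∎)
  where
  open ≤-Reasoning
  N = neighbours G v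
  N̄ = neighbours (complement G) v

walk-first-edge : ∀ {n} {E : Fin n → Fin n → Bool} {v u} → Walk E v u → v ≢ u → ∃ λ w → E v w ≡ true
walk-first-edge here v≢v = contradiction refl v≢v
walk-first-edge (step e _) _ = _ , e

disjointTrees≤degree : ∀ {n m} {H : Graph n} {S : Subset n} {u v} →
  HasDisjointTrees H S m → u ∈ S → v ∈ S → u ≢ v → m ≤ degree H v
disjointTrees≤degree {H = H} {S} {u} {v} (T , disjoint) u∈S v∈S u≢v =
  injection⇒≤degree H (proj₁ ∘ edge) edge-injective λ i → E⊆G (tree (T i)) v _ (proj₂ (edge i))
  where
  edge : ∀ i → ∃ λ w → E (tree (T i)) v w ≡ true
  edge i = walk-first-edge (proj₁ (isTree (T i)) v u (S⊆V (T i) v∈S) (S⊆V (T i) u∈S)) (u≢v ∘ sym)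
  edge-injective : Injective _≡_ _≡_ (proj₁ ∘ edge)
  edge-injective {i} {j} wᵢ≡wⱼ with i ≟ j
  ... | yes i≡j = i≡j
  ... | no i≢j with trans (sym (disjoint i j i≢j v _ (proj₂ (edge i))))
                         (subst (λ w → E (tree (T j)) v w ≡ true) (sym wᵢ≡wⱼ) (proj₂ (edge j)))
  ...   | ()

⊆-extend : ∀ {n k} (p : Subset n) → ∣ p ∣ ≤ k → k ≤ n → ∃ λ S → p ⊆ S × ∣ S ∣ ≡ k
⊆-extend [] _ z≤n = [] , (λ x∈[] → x∈[]) , refl
⊆-extend (inside ∷ p) (s≤s ∣p∣≤k) (s≤s k≤n) with ⊆-extend p ∣p∣≤k k≤n
... | S , p⊆S , refl = inside ∷ S , s⊆s p⊆S , refl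
⊆-extend {suc n} {k} (outside ∷ p) ∣p∣≤k k≤1+n with k ≤? n
... | yes k≤n = let S , p⊆S , ∣S∣≡k = ⊆-extend p ∣p∣≤k k≤n in
  outside ∷ S , s⊆s p⊆S , ∣S∣≡k
... | no k≰n = let S , p⊆S , ∣S∣≡n = ⊆-extend p (∣p∣≤n p) ≤-refl in
  inside ∷ S , out⊆ p⊆S , trans (cong suc ∣S∣≡n) (≤-antisym (≰⇒> k≰n) k≤1+n)

member-≢ : ∀ {n} {S : Subset n} v → 2 ≤ ∣ S ∣ → ∃ λ u → u ∈ S × u ≢ v
member-≢ {S = S} v 2≤∣S∣ with any? (λ u → (u ∈? S) ×-dec ¬? (u ≟ v))
... | yes found = found
... | no none = contradiction (≤-trans 2≤∣S∣ (≤-trans (p⊆q⇒∣p∣≤∣q∣ S⊆⁅v⁆) (≤-reflexive (∣⁅x⁆∣≡1 v)))) λ { (s≤s ()) }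
  where
  S⊆⁅v⁆ : S ⊆ ⁅ v ⁆
  S⊆⁅v⁆ {x} x∈S with x ≟ v
  ... | yes refl = x∈⁅x⁆ x
  ... | no x≢v = contradiction (x , x∈S , x≢v) none

¬¬-maximum : ∀ (P : ℕ → Set) {a} b → P a → (∀ m → P m → m ≤ b) →
             ¬ ¬ (∃ λ l → P l × ∀ m → P m → m ≤ l)
¬¬-maximum P {a} zero Pa bounded no-max = no-max (a , Pa , λ m Pm → ≤-trans (bounded m Pm) z≤n)
¬¬-maximum P (suc b) Pa bounded no-max = ¬¬-excluded-middle λ
  { (yes P[1+b]) → no-max (suc b , P[1+b] , bounded)
  ; (no ¬P[1+b]) → ¬¬-maximum P b Pa
      (λ m Pm → m<1+n⇒m≤n (≤∧≢⇒< (bounded m Pm) λ { refl → ¬P[1+b] Pm })) no-max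
  }

subset-through : ∀ {n k} v → 2 ≤ k → k ≤ n → ∃ λ S → ∣ S ∣ ≡ k × v ∈ S × ∃ λ u → u ∈ S × u ≢ v
subset-through v 2≤k k≤n =
  let S , ⁅v⁆⊆S , ∣S∣≡k = ⊆-extend ⁅ v ⁆ (≤-trans (≤-reflexive (∣⁅x⁆∣≡1 v)) (≤-trans (s≤s z≤n) 2≤k)) k≤n
  in S , ∣S∣≡k , ⁅v⁆⊆S (x∈⁅x⁆ v) , member-≢ v (≤-trans 2≤k (≤-reflexive (sym ∣S∣≡k)))

-- λ(S) is only known to exist classically; since the goal is decidable, ¬¬-existence suffices.
λₖ≤degree : ∀ {n k l} {H : Graph n} → 2 ≤ k → k ≤ n → IsLambdaK H k l → ∀ v → l ≤ degree H v
λₖ≤degree _ _ (inj₁ (_ , refl)) v = z≤n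
λₖ≤degree {k = k} {l} {H} 2≤k k≤n (inj₂ (_ , _ , λₖ≤λ)) v
  with subset-through v 2≤k k≤n
... | S , ∣S∣≡k , v∈S , u , u∈S , u≢v =
  decidable-stable (l ≤? degree H v)
    (¬¬-map l≤degree (¬¬-maximum (HasDisjointTrees H S) (degree H v) no-trees trees≤degree))
  where
  trees≤degree : ∀ m → HasDisjointTrees H S m → m ≤ degree H v
  trees≤degree m ts = disjointTrees≤degree ts u∈S v∈S u≢v
  no-trees : HasDisjointTrees H S 0
  no-trees = (λ ()) , λ ()
  l≤degree : ∃ (IsLambda H S) → l ≤ degree H v
  l≤degree (λS , isλ) = ≤-trans (λₖ≤λ S ∣S∣≡k λS isλ) (trees≤degree λS (proj₁ isλ))

maxDegree≤ : ∀ {n} (G : Graph n) {t} → (∀ v → degree G v ≤ t) → maxDegree G ≤ t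
maxDegree≤ G {t} d≤t = foldr-preservesᵇ {P = _≤ t} ⊔-lub z≤n (map⁺ (tabulate⁺ d≤t))

-- minDegree folds from the seed n, hence the hypothesis t ≤ n.
≤minDegree : ∀ {n} (G : Graph n) {t} → t ≤ n → (∀ v → t ≤ degree G v) → t ≤ minDegree G
≤minDegree G {t} t≤n t≤d = foldr-preservesᵇ {P = t ≤_} ⊓-glb t≤n (map⁺ (tabulate⁺ t≤d))

degree-spread : ∀ {n l c} (G : Graph n) → l ≤ n → (∀ v → l ≤ degree G v) →
  (∀ v → degree G v ≤ l + c) → maxDegree G ∸ minDegree G ≤ c
degree-spread {l = l} G l≤n l≤d d≤l+c =
  ≤-trans (∸-monoʳ-≤ (maxDegree G) (≤minDegree G l≤n l≤d)) (m≤n+o⇒m∸n≤o (maxDegree G) l (maxDegree≤ G d≤l+c))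

+-rearrange : ∀ a b c → a + b + suc c ≡ b + suc (a + c)
+-rearrange = solve-∀

b+d<n∧a+b≡n∸1+c⇒d≤a+c : ∀ {a b c d n} → b + d < n → a + b ≡ n ∸ suc c → suc c ≤ n → d ≤ a + c
b+d<n∧a+b≡n∸1+c⇒d≤a+c {a} {b} {c} {d} {n} b+d<n a+b≡ 1+c≤n = s≤s⁻¹ (+-cancelˡ-≤ b _ _ (begin
  b + suc d          ≡⟨ +-suc b d ⟩
  suc (b + d)        ≤⟨ b+d<n ⟩
  n                  ≡⟨ sym (m∸n+n≡m 1+c≤n) ⟩
  n ∸ suc c + suc c  ≡⟨ cong (_+ suc c) (sym a+b≡) ⟩
  a + b + suc c      ≡⟨ +-rearrange a b c ⟩
  b + suc (a + c)    ∎))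
  where open ≤-Reasoning

proposition5 : (n k : ℕ) → 2 ≤ k → k ≤ n → (G : Graph n) → (l₁ l₂ : ℕ) → IsLambdaK G k l₁ → IsLambdaK (complement G) k l₂ → l₁ + l₂ ≡ n ∸ ⌈ k /2⌉ → maxDegree G ∸ minDegree G ≤ ⌈ k /2⌉ ∸ 1
proposition5 n (suc zero) (s≤s ())
proposition5 n k@(suc (suc _)) 2≤k k≤n G l₁ l₂ λₖG λₖḠ l₁+l₂≡ =
  degree-spread G l₁≤n (λₖ≤degree 2≤k k≤n λₖG) degree≤l₁+⌈k/2⌉-1
  where
  ⌈k/2⌉≤n : ⌈ k /2⌉ ≤ n
  ⌈k/2⌉≤n = ≤-trans (⌈n/2⌉≤n k) k≤n
  l₁≤n : l₁ ≤ n
  l₁≤n = ≤-trans (m≤m+n l₁ l₂) (≤-trans (≤-reflexive l₁+l₂≡) (m∸n≤m n ⌈ k /2⌉))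
  degree≤l₁+⌈k/2⌉-1 : ∀ v → degree G v ≤ l₁ + (⌈ k /2⌉ ∸ 1)
  degree≤l₁+⌈k/2⌉-1 v = b+d<n∧a+b≡n∸1+c⇒d≤a+c
    (≤-<-trans (+-monoˡ-≤ (degree G v) (λₖ≤degree 2≤k k≤n λₖḠ v)) (degree-complement+degree<n G v))
    l₁+l₂≡ ⌈k/2⌉≤n
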